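{- Let $(\mathbf A,\perp,\{\mathsf t,\mathsf f\})$ be an $\mathfrak{N}_w^1$-model. Then for all $x,y,z\in A$: \[x\otimes y\precsim z\quad\text{iff}\quad x\precsim y\supset z.\] Consequently, $(A,\precsim,\otimes,\supset,{}^{*})$ is a partially ordered commutative involutive residuated groupoid.
   Context: For elements of an algebra $(A,\otimes,\circ,{}^{*})$: $u\Rightarrow v:=(u\circ v^{*})^{*}$; $u\Leftrightarrow v:=(u\Rightarrow v)\otimes(v\Rightarrow u)$; $u\not\Leftrightarrow v:=(u\Leftrightarrow v)^{*}$; $u\not\Leftrightarrow v\not\Leftrightarrow w:=((u\not\Leftrightarrow v)\otimes(u\not\Leftrightarrow w))\otimes(v\not\Leftrightarrow w)$; $u\oplus v:=(u^{*}\otimes v^{*})^{*}$; $u\supset v:=u^{*}\oplus v$. A weak $\mathcal{N}$-algebra is $\mathbf A=(A,\otimes,\circ,{}^{*})$ with $\otimes,\circ$ commutative, $x^{**}=x$, $(x\otimes y)\circ z=(x\otimes z)\circ y$. Fix distinct $\mathsf t,\mathsf f\notin A$, $\overline A=A\cup\{\mathsf t,\mathsf f\}$. An $\mathfrak{N}_{w}$-model is $(\mathbf A,\perp,\{\mathsf t,\mathsf f\})$ with $\mathbf A$ a weak $\mathcal N$-algebra, $\perp\subseteq\overline A\times\overline A$, and for all $x,y,z\in A$: (a) $x\perp x^{*}$; (b) $x\perp y^{*}$ and $y\perp x^{*}$ imply $x=y$; (c) $x\perp y$ iff $x\circ y\perp\mathsf t$; (d) $x\perp\mathsf t$ iff $x^{*}\perp\mathsf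 f$; (e) $x\perp\mathsf f$ and $y\perp\mathsf f$ iff $x\otimes y\perp\mathsf f$; (f) $(x\circ y^{*})^{*}\perp(x\circ y)^{*}$; (g) $x\perp y$ and $x\perp\mathsf f$ imply $y\perp\mathsf t$; (h) $x\not\Leftrightarrow y\not\Leftrightarrow z\perp((x\Rightarrow y)\Rightarrow((y\Rightarrow z)\Rightarrow(x\Rightarrow z)))^{*}$. An $\mathfrak{N}_w^1$-model is an $\mathfrak{N}_w$-model which moreover satisfies for all $x,y,z\in A$: $x\perp\mathsf f$ implies $x\oplus y\perp\mathsf f$; and $x\perp y^{*}$, $y\perp z^{*}$ imply $x\perp z^{*}$. On $A$ define $x\precsim y$ iff $x\perp y^{*}$. A partially ordered commutative involutive residuated groupoid is a structure $(A,\leq,\otimes,\supset,{}^{*})$ such that $(A,\otimes)$ is a commutative groupoid, $\leq$ is a partial order on $A$, ${}^{*}$ is an antitone involution ($x^{**}=x$; $x\leq y$ implies $y^{*}\leq x^{*}$), and $x\otimes y\leq z$ iff $x\leq y\supset z$ for all $x,y,z$. -}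

module Defs where

open import Level using (Level; _⊔_; suc)
open import Data.Product using (_×_)
open import Relation.Binary.PropositionalEquality using (_≡_)
open import Relation.Binary.Structures using (IsPartialOrder)
open import Algebra.Definitions using (Commutative)

data Ext {a : Level} (A : Set a) : Set a where
  el : A → Ext A
  𝗍  : Ext A
  𝖿  : Ext A

record IsWeakNAlgebra {a : Level} (A : Set a)
    (_⊗_ _∘_ : A → A → A) (_* : A → A) : Set a where
  field
    ⊗-comm : Commutative _≡_ _⊗_
    ∘-comm : Commutative _≡_ _∘_
    *-invol : ∀ x → (x *) * ≡ x
    ⊗∘-swap : ∀ x y z → (x ⊗ y) ∘ z ≡ (x ⊗ z) ∘ y

module Ops {a : Level} {A : Set a} (_⊗_ _∘_ : A → A → A) (_* : A → A) where
  infixr 5 _⇒_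
  _⇒_ : A → A → A
  u ⇒ v = (u ∘ (v *)) *

  _⇔_ : A → A → A
  u ⇔ v = (u ⇒ v) ⊗ (v ⇒ u)

  _⇎_ : A → A → A
  u ⇎ v = (u ⇔ v) *

  ⇎3 : A → A → A → A
  ⇎3 u v w = ((u ⇎ v) ⊗ (u ⇎ w)) ⊗ (v ⇎ w)

  _⊕_ : A → A → A
  u ⊕ v = ((u *) ⊗ (v *)) *

  _⊃_ : A → A → A
  u ⊃ v = (u *) ⊕ v

record IsNwModel {a ℓ : Level} (A : Set a)
    (_⊗_ _∘_ : A → A → A) (_* : A → A)
    (_⊥_ : Ext A → Ext A → Set ℓ) : Set (a ⊔ suc ℓ) where
  open Ops _⊗_ _∘_ _*
  field
    isWeakNAlgebra : IsWeakNAlgebra A _⊗_ _∘_ _*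
    ax-a : ∀ x → el x ⊥ el (x *)
    ax-b : ∀ x y → el x ⊥ el (y *) → el y ⊥ el (x *) → x ≡ y
    ax-c₁ : ∀ x y → el x ⊥ el y → el (x ∘ y) ⊥ 𝗍
    ax-c₂ : ∀ x y → el (x ∘ y) ⊥ 𝗍 → el x ⊥ el y
    ax-d₁ : ∀ x → el x ⊥ 𝗍 → el (x *) ⊥ 𝖿
    ax-d₂ : ∀ x → el (x *) ⊥ 𝖿 → el x ⊥ 𝗍
    ax-e₁ : ∀ x y → el x ⊥ 𝖿 → el y ⊥ 𝖿 → el (x ⊗ y) ⊥ 𝖿
    ax-e₂ : ∀ x y → el (x ⊗ y) ⊥ 𝖿 → (el x ⊥ 𝖿) × (el y ⊥ 𝖿)
    ax-f : ∀ x y → el ((x ∘ (y *)) *) ⊥ el ((x ∘ y) *)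
    ax-g : ∀ x y → el x ⊥ el y → el x ⊥ 𝖿 → el y ⊥ 𝗍
    ax-h : ∀ x y z →
      el (⇎3 x y z) ⊥ el (((x ⇒ y) ⇒ ((y ⇒ z) ⇒ (x ⇒ z))) *)

record IsNw1Model {a ℓ : Level} (A : Set a)
    (_⊗_ _∘_ : A → A → A) (_* : A → A)
    (_⊥_ : Ext A → Ext A → Set ℓ) : Set (a ⊔ suc ℓ) where
  open Ops _⊗_ _∘_ _*
  field
    isNwModel : IsNwModel A _⊗_ _∘_ _* _⊥_
    ax-⊕ : ∀ x y → el x ⊥ 𝖿 → el (x ⊕ y) ⊥ 𝖿
    ax-trans : ∀ x y z → el x ⊥ el (y *) → el y ⊥ el (z *) → el x ⊥ el (z *)

_≾[_,_]_ : {a ℓ : Level} {A : Set a} → A → (A → A) → (Ext A → Ext A → Set ℓ) → A → Set ℓ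
x ≾[ _* , _⊥_ ] y = el x ⊥ el (y *)

record IsPOCIRGroupoid {a ℓ : Level} (A : Set a) (_≤_ : A → A → Set ℓ)
    (_⊗_ _⊃_ : A → A → A) (_* : A → A) : Set (a ⊔ ℓ) where
  field
    isPartialOrder : IsPartialOrder _≡_ _≤_
    ⊗-comm : Commutative _≡_ _⊗_
    *-invol : ∀ x → (x *) * ≡ x
    *-antitone : ∀ x y → x ≤ y → (y *) ≤ (x *)
    residuated₁ : ∀ x y z → (x ⊗ y) ≤ z → x ≤ (y ⊃ z)
    residuated₂ : ∀ x y z → x ≤ (y ⊃ z) → (x ⊗ y) ≤ z

{-# OPTIONS --safe #-}
module Submission where

open import Defs
open import Level using (Level)
open import Data.Product using (_×_; _,_)
open import Function.Bundles using (_⇔_; mk⇔; Equivalence)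
open import Relation.Binary.PropositionalEquality
  using (_≡_; refl; sym; cong; subst; isEquivalence; module ≡-Reasoning)
open import Relation.Binary.Structures using (IsPartialOrder)

-- Proof idea: by (c) and commutativity of ∘, whether u ⊥ v holds depends only
-- on u ∘ v.  Since (y ⊃ z)* = y ⊗ z* and the weak N-algebra law makes
-- (x ⊗ y) ∘ z* = x ∘ (y ⊗ z*), the statements x ⊗ y ≾ z and x ≾ y ⊃ z are
-- both "the same product is ⊥ t".

module WeakNAlgebraProperties {a : Level} {A : Set a} {_⊗_ _∘_ : A → A → A} {_* : A → A}
    (W : IsWeakNAlgebra A _⊗_ _∘_ _*) where

  open IsWeakNAlgebra W
  open Ops _⊗_ _∘_ _* using (_⊃_)
  open ≡-Reasoning

  ⊃-dual : ∀ y z → (y ⊃ z) * ≡ y ⊗ (z *)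
  ⊃-dual y z = begin
    ((((y *) *) ⊗ (z *)) *) *  ≡⟨ *-invol _ ⟩
    ((y *) *) ⊗ (z *)          ≡⟨ cong (_⊗ (z *)) (*-invol y) ⟩
    y ⊗ (z *)                  ∎

  ⊗-∘-assoc : ∀ x y w → (x ⊗ y) ∘ w ≡ x ∘ (y ⊗ w)
  ⊗-∘-assoc x y w = begin
    (x ⊗ y) ∘ w  ≡⟨ cong (_∘ w) (⊗-comm x y) ⟩
    (y ⊗ x) ∘ w  ≡⟨ ⊗∘-swap y x w ⟩
    (y ⊗ w) ∘ x  ≡⟨ ∘-comm (y ⊗ w) x ⟩
    x ∘ (y ⊗ w)  ∎

module NwModelProperties {a ℓ : Level} {A : Set a} {_⊗_ _∘_ : A → A → A} {_* : A → A}
    {_⊥_ : Ext A → Ext A → Set ℓ} (M : IsNwModel A _⊗_ _∘_ _* _⊥_) where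

  open IsNwModel M
  open IsWeakNAlgebra isWeakNAlgebra
  open WeakNAlgebraProperties isWeakNAlgebra
  open Ops _⊗_ _∘_ _* using (_⊃_)

  _≾_ : A → A → Set ℓ
  x ≾ y = x ≾[ _* , _⊥_ ] y

  ⊥-resp-∘ : ∀ {x y u v} → x ∘ y ≡ u ∘ v → el x ⊥ el y → el u ⊥ el v
  ⊥-resp-∘ {x} {y} {u} {v} eq x⊥y =
    ax-c₂ u v (subst (λ w → el w ⊥ 𝗍) eq (ax-c₁ x y x⊥y))

  ⊥-sym : ∀ {x y} → el x ⊥ el y → el y ⊥ el x
  ⊥-sym {x} {y} = ⊥-resp-∘ (∘-comm x y)

  ⊥-respʳ-≡ : ∀ {x y y′} → y ≡ y′ → el x ⊥ el y → el x ⊥ el y′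
  ⊥-respʳ-≡ {x} = subst (λ w → el x ⊥ el w)

  ≾-antitone : ∀ x y → x ≾ y → (y *) ≾ (x *)
  ≾-antitone x y x≾y = ⊥-respʳ-≡ (sym (*-invol x)) (⊥-sym x≾y)

  ≾-residuated : ∀ x y z → ((x ⊗ y) ≾ z) ⇔ (x ≾ (y ⊃ z))
  ≾-residuated x y z = mk⇔
    (λ xy≾z → ⊥-respʳ-≡ (sym (⊃-dual y z)) (⊥-resp-∘ (⊗-∘-assoc x y (z *)) xy≾z))
    (λ x≾y⊃z → ⊥-resp-∘ (sym (⊗-∘-assoc x y (z *))) (⊥-respʳ-≡ (⊃-dual y z) x≾y⊃z))

module Nw1ModelProperties {a ℓ : Level} {A : Set a} {_⊗_ _∘_ : A → A → A} {_* : A → A}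
    {_⊥_ : Ext A → Ext A → Set ℓ} (M : IsNw1Model A _⊗_ _∘_ _* _⊥_) where

  open IsNw1Model M
  open IsNwModel isNwModel using (isWeakNAlgebra; ax-a; ax-b)
  open IsWeakNAlgebra isWeakNAlgebra using (⊗-comm; *-invol)
  open Ops _⊗_ _∘_ _* using (_⊃_)
  open NwModelProperties isNwModel public

  ≾-isPartialOrder : IsPartialOrder _≡_ _≾_
  ≾-isPartialOrder = record
    { isPreorder = record
      { isEquivalence = isEquivalence
      ; reflexive = λ { {x} refl → ax-a x }
      ; trans = λ {x} {y} {z} → ax-trans x y z
      }
    ; antisym = λ {x} {y} → ax-b x y
    }

  ≾-isPOCIRGroupoid : IsPOCIRGroupoid A _≾_ _⊗_ _⊃_ _*
  ≾-isPOCIRGroupoid = record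
    { isPartialOrder = ≾-isPartialOrder
    ; ⊗-comm = ⊗-comm
    ; *-invol = *-invol
    ; *-antitone = ≾-antitone
    ; residuated₁ = λ x y z → Equivalence.to (≾-residuated x y z)
    ; residuated₂ = λ x y z → Equivalence.from (≾-residuated x y z)
    }

proposition6p14 : {a ℓ : Level} (A : Set a) (_⊗_ _∘_ : A → A → A) (_* : A → A)
    (_⊥_ : Ext A → Ext A → Set ℓ) →
    IsNw1Model A _⊗_ _∘_ _* _⊥_ →
    ((∀ x y z → ((x ⊗ y) ≾[ _* , _⊥_ ] z) ⇔ (x ≾[ _* , _⊥_ ] Ops._⊃_ _⊗_ _∘_ _* y z))
    × IsPOCIRGroupoid A (λ x y → x ≾[ _* , _⊥_ ] y) _⊗_ (Ops._⊃_ _⊗_ _∘_ _*) _*)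
proposition6p14 A _⊗_ _∘_ _* _⊥_ M = ≾-residuated , ≾-isPOCIRGroupoid
  where open Nw1ModelProperties M
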